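{- For each integer $n\ge 1$ there exists a Steiner triple system $L$ of order $6n+3$ such that $\mathcal{D}(L,3)=6n+3$. Consequently $\mathcal{D}(6n+3,3)=6n+3$.
   Context: A Steiner triple system of order $v$, $\mathrm{STS}(v)$, is a pair $(V,\mathcal{B})$ where $|V|=v$ and $\mathcal{B}$ is a collection of $3$-subsets of $V$ (blocks) such that every $2$-subset of $V$ lies in exactly one block. A $3$-coloring is a map $\phi:V\to C$ with $|C|=3$ such that no block is monochromatic. A defining set of a $3$-coloring $\phi$ is a subset $S\subseteq V$ together with the colors $\phi|_S$ such that $\phi$ is the unique $3$-coloring of $(V,\mathcal{B})$ extending $\phi|_S$. A defining set is minimal if no proper subset of it (with the restricted colors) is a defining set of the same coloring. For an $\mathrm{STS}(v)$ $D$ admitting a $3$-coloring, $\mathcal{D}(D,3)$ is the largest cardinality of a minimal defining set of a $3$-coloring of $D$ (maximum over all $3$-colorings and all their minimal defining sets), and $\mathcal{D}(v,3)=\max\{\mathcal{D}(D,3)\}$ over all $3$-chromatic Steiner triple systems $D$ of order $v$. -}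

module Defs where

open import Data.Nat using (ℕ; _≤_)
open import Data.Fin using (Fin)
open import Data.Fin.Subset using (Subset; _∈_; _⊂_; ∣_∣)
open import Data.Product using (Σ; ∃; _×_)
open import Relation.Nullary using (¬_)
open import Relation.Binary.PropositionalEquality using (_≡_; _≢_)

-- The blocks are an indexed family  block : Fin b → Subset v  of 3-subsets;
-- every pair of distinct points lies in some block, and in exactly one
-- (the index is unique, which also forces the blocks to be pairwise distinct,
-- so the family is a genuine collection of 3-subsets).
record STS (v : ℕ) : Set where
  field
    b      : ℕ
    block  : Fin b → Subset v
    size3  : ∀ i → ∣ block i ∣ ≡ 3
    cover  : ∀ x y → x ≢ y → ∃ λ i → x ∈ block i × y ∈ block i
    unique : ∀ x y i j → x ≢ y → x ∈ block i → y ∈ block i →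
             x ∈ block j → y ∈ block j → i ≡ j

open STS public

IsColoring : ∀ {v} (D : STS v) (k : ℕ) → (Fin v → Fin k) → Set
IsColoring D k φ = ∀ i (c : Fin k) → ¬ (∀ x → x ∈ block D i → φ x ≡ c)

Is3Coloring : ∀ {v} (D : STS v) → (Fin v → Fin 3) → Set
Is3Coloring D φ = IsColoring D 3 φ

ThreeColorable : ∀ {v} → STS v → Set
ThreeColorable D = ∃ λ φ → Is3Coloring D φ

ThreeChromatic : ∀ {v} → STS v → Set
ThreeChromatic D = ThreeColorable D × ¬ (∃ λ (ψ : _ → Fin 2) → IsColoring D 2 ψ)

IsDefiningSet : ∀ {v} (D : STS v) (φ : Fin v → Fin 3) (S : Subset v) → Set
IsDefiningSet D φ S =
  Is3Coloring D φ ×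
  (∀ ψ → Is3Coloring D ψ → (∀ x → x ∈ S → ψ x ≡ φ x) → ∀ x → ψ x ≡ φ x)

IsMinimalDefiningSet : ∀ {v} (D : STS v) (φ : Fin v → Fin 3) (S : Subset v) → Set
IsMinimalDefiningSet D φ S =
  IsDefiningSet D φ S × (∀ S′ → S′ ⊂ S → ¬ IsDefiningSet D φ S′)

-- 𝒟(D,3) = m : m is the largest cardinality of a minimal defining set of a
-- 3-coloring of D (attained, and an upper bound).
HasDefNum : ∀ {v} (D : STS v) (m : ℕ) → Set
HasDefNum D m =
  (∃ λ φ → Σ (Subset _) λ S → IsMinimalDefiningSet D φ S × ∣ S ∣ ≡ m) ×
  (∀ φ S → IsMinimalDefiningSet D φ S → ∣ S ∣ ≤ m)

-- 𝒟(v,3) = m : maximum of 𝒟(D,3) over all 3-chromatic STS(v) D.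
HasDefNumOrder : (v m : ℕ) → Set
HasDefNumOrder v m =
  (∃ λ (D : STS v) → ThreeChromatic D × HasDefNum D m) ×
  (∀ (D : STS v) → ThreeChromatic D → ∀ k → HasDefNum D k → k ≤ m)

-- The Bose construction gives an STS on ℤ₃ × ℤₘ, m = 2n + 1: the columns {0,1,2} × {x} and the
-- triples {(i, z − r), (i, z + r), (i + 1, z)} for 1 ≤ r ≤ n.  Coloring each point by its level i is
-- proper, and it stays proper when any single point is moved up one level, because the levels on a
-- block are {0,1,2} or {i,i,i+1}.  So no point's color is forced by the others, and the whole point
-- set is a minimal defining set of size 6n + 3.
--
-- The system is 3-chromatic because no STS of order v > 3 has a 2-coloring.  For a point x the
-- third-point map of the lines through x is an involution; it sends the other points colored like x
-- to points colored differently, and the remaining differently colored points pair up.  Writing f(x)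
-- for the number of points in those pairs, #unlike + 1 = #like + f(x); adding this for two points of
-- different colors gives f(x) + f(y) = 2, and f ≠ 1, so one color class has f = 0 and the other
-- f = 2.  The latter class has (v − 1)/2 ≥ 2 points, and any two of them would complete the same
-- pair a, a′ to a line, which is impossible.
module Submission where

open import Data.Nat using (ℕ; zero; suc; _+_; _*_; _∸_; _≤_; _<_; _≤?_; _<?_; z≤n; s≤s; NonZero)
open import Data.Nat.Properties
  using (+-comm; +-identityʳ; +-suc; +-cancelˡ-≡; +-cancelʳ-≡; *-comm; ≤-trans; <⇒≤; <⇒≢; <-trans; <-irrefl;
         ≰⇒>; ≮⇒≥; m≤m+n; m≤n+m; +-mono-≤; +-mono-<; ∸-monoʳ-≤; ∸-monoˡ-<;
         m∸n+n≡m; m+n∸m≡n; m+n∸n≡m; m+[n∸m]≡n; m<n⇒0<n∸m; n≢0⇒n>0; 1+n≢0; +-0-commutativeMonoid)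
open import Data.Nat.DivMod
  using (_%_; _mod_; %-distribˡ-+; %-distribˡ-*; [m+kn]%n≡m%n; m%n%n≡m%n; m<n⇒m%n≡m; m%n<n)
open import Data.Nat.Tactic.RingSolver using (solve-∀)
open import Data.Fin using (Fin; zero; suc; toℕ; _≟_)
open import Data.Fin.Patterns using (0F; 1F; 2F)
open import Data.Fin.Properties using (any?; toℕ-fromℕ<; toℕ<n; toℕ-injective; suc-injective; +↔⊎; *↔×)
open import Data.Fin.Permutation using (Permutation′; permutation; _⟨$⟩ʳ_)
open import Data.Fin.Subset using (Subset; ⊤; ⁅_⁆; _∪_; _∈_; _∉_; _⊆_; _⊂_; ∣_∣; inside; outside)
open import Data.Fin.Subset.Properties
  using (_∈?_; ∈⊤; ∣⊤∣≡n; ∣p∣≤n; p⊆q⇒∣p∣≤∣q∣; x∈p∪q⁻; x∈p∪q⁺; x∈⁅x⁆; x∈⁅y⁆⇒x≡y; ∣⁅x⁆∣≡1;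
         ∪-identityˡ)
open import Data.Vec using (_∷_; here; there)
open import Data.Vec.Functional using (updateAt)
open import Data.Vec.Functional.Properties using (updateAt-updates; updateAt-minimal)
open import Data.Product using (∃; _×_; _,_; proj₁; proj₂)
open import Data.Product.Function.NonDependent.Propositional using (_×-↔_)
open import Data.Sum using (_⊎_; inj₁; inj₂)
open import Data.Sum.Function.Propositional using (_⊎-↔_)
open import Data.Empty using (⊥; ⊥-elim)
open import Function using (_∘_; const; _↔_; Inverse)
open import Function.Construct.Identity using (↔-id)
open import Function.Construct.Symmetry using (↔-sym)
open import Function.Construct.Composition using (_↔-∘_)
open import Relation.Nullary using (¬_; Dec; yes; no; ¬?; _×-dec_)
open import Relation.Nullary.Decidable using (decidable-stable)
open import Relation.Unary using (Pred; Decidable)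
open import Relation.Binary.Bundles using (Setoid)
open import Relation.Binary.PropositionalEquality
  using (_≡_; _≢_; refl; sym; trans; cong; cong₂; subst; subst₂; module ≡-Reasoning)
import Relation.Binary.Reasoning.Setoid as SetoidReasoning
open import Algebra.Properties.CommutativeMonoid.Sum +-0-commutativeMonoid
  using (sum; ∑-distrib-+; sum-permute; sum-cong-≗)
open import Defs

-- Three-element subsets

∣⁅x⁆∪p∣≡1+∣p∣ : ∀ {n} (x : Fin n) (p : Subset n) → x ∉ p → ∣ ⁅ x ⁆ ∪ p ∣ ≡ suc ∣ p ∣
∣⁅x⁆∪p∣≡1+∣p∣ zero    (outside ∷ p) x∉p = cong (suc ∘ ∣_∣) (∪-identityˡ p)
∣⁅x⁆∪p∣≡1+∣p∣ zero    (inside ∷ p)  x∉p = ⊥-elim (x∉p here)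
∣⁅x⁆∪p∣≡1+∣p∣ (suc x) (outside ∷ p) x∉p = ∣⁅x⁆∪p∣≡1+∣p∣ x p (x∉p ∘ there)
∣⁅x⁆∪p∣≡1+∣p∣ (suc x) (inside ∷ p)  x∉p = cong suc (∣⁅x⁆∪p∣≡1+∣p∣ x p (x∉p ∘ there))

∈⁅x,y⁆⁻ : ∀ {n} {w x y : Fin n} → w ∈ ⁅ x ⁆ ∪ ⁅ y ⁆ → w ≡ x ⊎ w ≡ y
∈⁅x,y⁆⁻ {x = x} {y} w∈ with x∈p∪q⁻ ⁅ x ⁆ ⁅ y ⁆ w∈
... | inj₁ w∈x = inj₁ (x∈⁅y⁆⇒x≡y x w∈x)
... | inj₂ w∈y = inj₂ (x∈⁅y⁆⇒x≡y y w∈y)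

∣⁅x,y⁆∣≡2 : ∀ {n} {x y : Fin n} → x ≢ y → ∣ ⁅ x ⁆ ∪ ⁅ y ⁆ ∣ ≡ 2
∣⁅x,y⁆∣≡2 {x = x} {y} x≢y = trans (∣⁅x⁆∪p∣≡1+∣p∣ x ⁅ y ⁆ (x≢y ∘ x∈⁅y⁆⇒x≡y y)) (cong suc (∣⁅x⁆∣≡1 y))

module _ {n} {p : Subset n} (∣p∣≡3 : ∣ p ∣ ≡ 3)
         {x y : Fin n} (x∈p : x ∈ p) (y∈p : y ∈ p) (x≢y : x ≢ y) where

  private
    ∉⁅x,y⁆ : ∀ {z} → z ≢ x → z ≢ y → z ∉ ⁅ x ⁆ ∪ ⁅ y ⁆
    ∉⁅x,y⁆ z≢x z≢y z∈ with ∈⁅x,y⁆⁻ z∈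
    ... | inj₁ z≡x = z≢x z≡x
    ... | inj₂ z≡y = z≢y z≡y

  ∣p∣≡3⇒third : ∃ λ z → z ∈ p × z ≢ x × z ≢ y
  ∣p∣≡3⇒third with any? (λ z → z ∈? p ×-dec ¬? (z ≟ x) ×-dec ¬? (z ≟ y))
  ... | yes third = third
  ... | no ∄third = ⊥-elim (3≰2 (subst₂ _≤_ ∣p∣≡3 (∣⁅x,y⁆∣≡2 x≢y) (p⊆q⇒∣p∣≤∣q∣ p⊆⁅x,y⁆)))
    where
    3≰2 : ¬ 3 ≤ 2
    3≰2 (s≤s (s≤s ()))
    p⊆⁅x,y⁆ : p ⊆ ⁅ x ⁆ ∪ ⁅ y ⁆
    p⊆⁅x,y⁆ {w} w∈p with w ≟ x | w ≟ y
    ... | yes refl | _        = x∈p∪q⁺ (inj₁ (x∈⁅x⁆ w))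
    ... | no _     | yes refl = x∈p∪q⁺ (inj₂ (x∈⁅x⁆ w))
    ... | no w≢x   | no w≢y   = ⊥-elim (∄third (w , w∈p , w≢x , w≢y))

  ∣p∣≡3⇒third-unique : ∀ {z w} → z ∈ p → w ∈ p → z ≢ x → z ≢ y → w ≢ x → w ≢ y → z ≡ w
  ∣p∣≡3⇒third-unique {z} {w} z∈p w∈p z≢x z≢y w≢x w≢y with z ≟ w
  ... | yes z≡w = z≡w
  ... | no z≢w = ⊥-elim (4≰3 (subst₂ _≤_ ∣q∣≡4 ∣p∣≡3 (p⊆q⇒∣p∣≤∣q∣ q⊆p)))
    where
    4≰3 : ¬ 4 ≤ 3
    4≰3 (s≤s (s≤s (s≤s ())))
    q = ⁅ z ⁆ ∪ (⁅ w ⁆ ∪ (⁅ x ⁆ ∪ ⁅ y ⁆))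
    z∉ : z ∉ ⁅ w ⁆ ∪ (⁅ x ⁆ ∪ ⁅ y ⁆)
    z∉ z∈ with x∈p∪q⁻ ⁅ w ⁆ _ z∈
    ... | inj₁ z∈w  = z≢w (x∈⁅y⁆⇒x≡y w z∈w)
    ... | inj₂ z∈xy = ∉⁅x,y⁆ z≢x z≢y z∈xy
    ∣q∣≡4 : ∣ q ∣ ≡ 4
    ∣q∣≡4 = trans (∣⁅x⁆∪p∣≡1+∣p∣ z _ z∉)
              (cong suc (trans (∣⁅x⁆∪p∣≡1+∣p∣ w _ (∉⁅x,y⁆ w≢x w≢y)) (cong suc (∣⁅x,y⁆∣≡2 x≢y))))
    q⊆p : q ⊆ p
    q⊆p u∈ with x∈p∪q⁻ ⁅ z ⁆ _ u∈
    ... | inj₁ u∈z rewrite x∈⁅y⁆⇒x≡y z u∈z = z∈p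
    ... | inj₂ u∈ with x∈p∪q⁻ ⁅ w ⁆ _ u∈
    ...   | inj₁ u∈w rewrite x∈⁅y⁆⇒x≡y w u∈w = w∈p
    ...   | inj₂ u∈xy with ∈⁅x,y⁆⁻ u∈xy
    ...     | inj₁ refl = x∈p
    ...     | inj₂ refl = y∈p

-- Counting

indicator : ∀ {p} {P : Set p} → Dec P → ℕ
indicator (yes _) = 1
indicator (no _)  = 0

indicator-cong : ∀ {p q} {P : Set p} {Q : Set q} → (P → Q) → (Q → P) → (P? : Dec P) (Q? : Dec Q) →
                 indicator P? ≡ indicator Q?
indicator-cong _   _   (yes _) (yes _) = refl
indicator-cong P→Q _   (yes p) (no ¬q) = ⊥-elim (¬q (P→Q p))
indicator-cong _   Q→P (no ¬p) (yes q) = ⊥-elim (¬p (Q→P q))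
indicator-cong _   _   (no _)  (no _)  = refl

count : ∀ {n p} {P : Pred (Fin n) p} → Decidable P → ℕ
count P? = sum (indicator ∘ P?)

module _ {n p q} {P : Pred (Fin n) p} {Q : Pred (Fin n) q} (P? : Decidable P) (Q? : Decidable Q) where

  count-cong : (∀ {i} → P i → Q i) → (∀ {i} → Q i → P i) → count P? ≡ count Q?
  count-cong P→Q Q→P = sum-cong-≗ (λ i → indicator-cong P→Q Q→P (P? i) (Q? i))

  count-split : count P? ≡ count (λ i → P? i ×-dec Q? i) + count (λ i → P? i ×-dec ¬? (Q? i))
  count-split = trans (sum-cong-≗ split)
                      (∑-distrib-+ (λ i → indicator (P? i ×-dec Q? i)) (λ i → indicator (P? i ×-dec ¬? (Q? i))))
    where
    split : ∀ i → indicator (P? i) ≡ indicator (P? i ×-dec Q? i) + indicator (P? i ×-dec ¬? (Q? i))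
    split i with P? i | Q? i
    ... | yes _ | yes _ = refl
    ... | yes _ | no _  = refl
    ... | no _  | _     = refl

count-permute : ∀ {n p} {P : Pred (Fin n) p} (π : Permutation′ n) (P? : Decidable P) →
                count P? ≡ count (P? ∘ (π ⟨$⟩ʳ_))
count-permute π P? = sum-permute (indicator ∘ P?) π

count-none : ∀ {n p} {P : Pred (Fin n) p} (P? : Decidable P) → (∀ i → ¬ P i) → count P? ≡ 0
count-none {zero}  P? ∄P = refl
count-none {suc n} P? ∄P with P? zero
... | yes P0 = ⊥-elim (∄P zero P0)
... | no _   = count-none (P? ∘ suc) (∄P ∘ suc)

count-witness : ∀ {n p} {P : Pred (Fin n) p} (P? : Decidable P) → count P? ≢ 0 → ∃ P
count-witness {zero}  P? count≢0 = ⊥-elim (count≢0 refl)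
count-witness {suc n} P? count≢0 with P? zero
... | yes P0 = zero , P0
... | no _ with count-witness (P? ∘ suc) count≢0
...   | i , Pi = suc i , Pi

count-≡ : ∀ {n} (a : Fin n) → count (_≟ a) ≡ 1
count-≡ {suc n} zero    = cong suc (count-none {n} (λ i → suc i ≟ zero) (λ _ ()))
count-≡ {suc n} (suc a) = trans (count-cong {n} (λ i → suc i ≟ suc a) (_≟ a) suc-injective (cong suc)) (count-≡ a)

count-remove : ∀ {n p} {P : Pred (Fin n) p} (P? : Decidable P) {a} → P a →
               count P? ≡ suc (count (λ i → P? i ×-dec ¬? (i ≟ a)))
count-remove P? {a} Pa = begin
  count P?                                   ≡⟨ count-split P? (_≟ a) ⟩
  count (λ i → P? i ×-dec i ≟ a) + count P∖a  ≡⟨ cong (_+ count P∖a) only-a ⟩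
  suc (count P∖a)                            ∎
  where
  open ≡-Reasoning
  P∖a = λ i → P? i ×-dec ¬? (i ≟ a)
  only-a : count (λ i → P? i ×-dec i ≟ a) ≡ 1
  only-a = trans (count-cong (λ i → P? i ×-dec i ≟ a) (_≟ a) proj₂ (λ { refl → Pa , refl })) (count-≡ a)

count-total : ∀ {n p} {P : Pred (Fin n) p} (P? : Decidable P) → count P? + count (¬? ∘ P?) ≡ n
count-total {zero}  P? = refl
count-total {suc n} P? with P? zero
... | yes _ = cong suc (count-total (P? ∘ suc))
... | no _  = trans (+-suc _ _) (cong suc (count-total (P? ∘ suc)))

count-zero : ∀ {n p} {P : Pred (Fin n) p} (P? : Decidable P) → count P? ≡ 0 → ∀ {i} → ¬ P i
count-zero P? count≡0 Pi with trans (sym (count-remove P? Pi)) count≡0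
... | ()

count-two : ∀ {n p} {P : Pred (Fin n) p} (P? : Decidable P) {a b} → P a → P b → a ≢ b → 2 ≤ count P?
count-two P? {a} Pa Pb a≢b
  rewrite count-remove P? Pa | count-remove (λ i → P? i ×-dec ¬? (i ≟ a)) (Pb , a≢b ∘ sym) = s≤s (s≤s z≤n)

count-three : ∀ {n p} {P : Pred (Fin n) p} (P? : Decidable P) {a b c} →
              P a → P b → P c → a ≢ b → a ≢ c → b ≢ c → 3 ≤ count P?
count-three P? {a} {b} Pa Pb Pc a≢b a≢c b≢c
  rewrite count-remove P? Pa
        | count-remove (λ i → P? i ×-dec ¬? (i ≟ a)) (Pb , a≢b ∘ sym)
        | count-remove (λ i → (P? i ×-dec ¬? (i ≟ a)) ×-dec ¬? (i ≟ b)) ((Pc , a≢c ∘ sym) , b≢c ∘ sym)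
        = s≤s (s≤s (s≤s z≤n))

-- Lines of a Steiner triple system

module Lines {v} (D : STS v) where

  Collinear : Fin v → Fin v → Fin v → Set
  Collinear x y z = ∃ λ i → x ∈ block D i × y ∈ block D i × z ∈ block D i

  collinear-unique : ∀ {x y z w} → x ≢ y → Collinear x y z → Collinear x y w →
                     z ≢ x → z ≢ y → w ≢ x → w ≢ y → z ≡ w
  collinear-unique {x} {y} x≢y (i , x∈i , y∈i , z∈i) (j , x∈j , y∈j , w∈j)
    with unique D x y i j x≢y x∈i y∈i x∈j y∈j
  ... | refl = ∣p∣≡3⇒third-unique (size3 D i) x∈i y∈i x≢y z∈i w∈j

  private
    third : ∀ {x y} → x ≢ y → ∃ λ z → Collinear x y z × z ≢ x × z ≢ y
    third {x} {y} x≢y with cover D x y x≢y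
    ... | i , x∈i , y∈i with ∣p∣≡3⇒third (size3 D i) x∈i y∈i x≢y
    ...   | z , z∈i , z≢x , z≢y = z , (i , x∈i , y∈i , z∈i) , z≢x , z≢y

  -- line x x = x makes line x an involution of the whole point set.
  line : Fin v → Fin v → Fin v
  line x y with y ≟ x
  ... | yes _  = x
  ... | no y≢x = proj₁ (third (y≢x ∘ sym))

  line-self : ∀ x → line x x ≡ x
  line-self x with x ≟ x
  ... | yes _  = refl
  ... | no x≢x = ⊥-elim (x≢x refl)

  private
    line-spec : ∀ {x y} → x ≢ y → Collinear x y (line x y) × line x y ≢ x × line x y ≢ y
    line-spec {x} {y} x≢y with y ≟ x
    ... | yes refl = ⊥-elim (x≢y refl)
    ... | no y≢x   = proj₂ (third (y≢x ∘ sym))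

  line-collinear : ∀ {x y} → x ≢ y → Collinear x y (line x y)
  line-collinear = proj₁ ∘ line-spec

  line-≢ˡ : ∀ {x y} → x ≢ y → line x y ≢ x
  line-≢ˡ = proj₁ ∘ proj₂ ∘ line-spec

  line-≢ʳ : ∀ {x y} → x ≢ y → line x y ≢ y
  line-≢ʳ = proj₂ ∘ proj₂ ∘ line-spec

  line-unique : ∀ {x y z} → x ≢ y → Collinear x y z → z ≢ x → z ≢ y → line x y ≡ z
  line-unique x≢y xyz z≢x z≢y =
    collinear-unique x≢y (line-collinear x≢y) xyz (line-≢ˡ x≢y) (line-≢ʳ x≢y) z≢x z≢y

  line-comm : ∀ {x y} → x ≢ y → line x y ≡ line y x
  line-comm x≢y with line-collinear (x≢y ∘ sym)
  ... | i , y∈i , x∈i , ℓ∈i =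
    line-unique x≢y (i , x∈i , y∈i , ℓ∈i) (line-≢ʳ (x≢y ∘ sym)) (line-≢ˡ (x≢y ∘ sym))

  line-line : ∀ {x y} → x ≢ y → line y (line x y) ≡ x
  line-line x≢y with line-collinear x≢y
  ... | i , x∈i , y∈i , ℓ∈i =
    line-unique (line-≢ʳ x≢y ∘ sym) (i , y∈i , ℓ∈i , x∈i) x≢y (line-≢ˡ x≢y ∘ sym)

  line-involutive : ∀ x y → line x (line x y) ≡ y
  line-involutive x y = by-cases (y ≟ x)
    where
    by-cases : Dec (y ≡ x) → line x (line x y) ≡ y
    by-cases (yes refl) = trans (cong (line x) (line-self x)) (line-self x)
    by-cases (no y≢x)   = trans (cong (line x) (line-comm (y≢x ∘ sym))) (line-line y≢x)

  line-color : ∀ {k} {ψ : Fin v → Fin k} → IsColoring D k ψ →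
               ∀ {x y} → x ≢ y → ψ x ≡ ψ y → ψ (line x y) ≢ ψ x
  line-color {ψ = ψ} proper {x} {y} x≢y ψx≡ψy ψℓ≡ψx with line-collinear x≢y
  ... | i , x∈i , y∈i , ℓ∈i = proper i (ψ x) monochromatic
    where
    monochromatic : ∀ w → w ∈ block D i → ψ w ≡ ψ x
    monochromatic w w∈i with w ≟ x | w ≟ y
    ... | yes refl | _        = refl
    ... | no _     | yes refl = sym ψx≡ψy
    ... | no w≢x   | no w≢y   =
      subst (λ u → ψ u ≡ ψ x) (line-unique x≢y (i , x∈i , y∈i , w∈i) w≢x w≢y) ψℓ≡ψx

-- 2-colorings

module LineCounts {v} (D : STS v) {k} {ψ : Fin v → Fin k} (proper : IsColoring D k ψ) where
  open Lines D

  like : ∀ x → Decidable (λ z → ψ z ≡ ψ x)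
  like x z = ψ z ≟ ψ x

  unlike : ∀ x → Decidable (λ z → ψ z ≢ ψ x)
  unlike x z = ¬? (like x z)

  unlike⇒≢ : ∀ {x z} → ψ z ≢ ψ x → x ≢ z
  unlike⇒≢ ψz≢ψx refl = ψz≢ψx refl

  Foreign? : ∀ x → Decidable (λ z → ψ z ≢ ψ x × ψ (line x z) ≢ ψ x)
  Foreign? x z = unlike x z ×-dec unlike x (line x z)

  foreign : Fin v → ℕ
  foreign x = count (Foreign? x)

  -- line x maps the points colored like x, except x itself, onto the unlike points whose
  -- partner is colored like x; the other unlike points are the foreign ones.
  balance : ∀ x → count (unlike x) + 1 ≡ count (like x) + foreign x
  balance x = begin
    count (unlike x) + 1
      ≡⟨ cong (_+ 1) (count-split (unlike x) (like x ∘ line x)) ⟩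
    count (λ z → unlike x z ×-dec like x (line x z)) + foreign x + 1
      ≡⟨ cong (λ c → c + foreign x + 1) reflected ⟩
    count like∖x + foreign x + 1
      ≡⟨ shuffle (count like∖x) (foreign x) ⟩
    suc (count like∖x) + foreign x
      ≡⟨ cong (_+ foreign x) (count-remove (like x) refl) ⟨
    count (like x) + foreign x
      ∎
    where
    open ≡-Reasoning
    like∖x = λ z → like x z ×-dec ¬? (z ≟ x)
    shuffle : ∀ a b → a + b + 1 ≡ suc a + b
    shuffle = solve-∀
    reflected : count (λ z → unlike x z ×-dec like x (line x z)) ≡ count like∖x
    reflected = trans (count-permute (permutation (line x) (line x) (line-involutive x) (line-involutive x)) _)
                      (count-cong _ like∖x to from)
      where
      to : ∀ {z} → ψ (line x z) ≢ ψ x × ψ (line x (line x z)) ≡ ψ x → ψ z ≡ ψ x × z ≢ x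
      to {z} (ψℓz≢ψx , ψℓℓz≡ψx) =
        subst (λ u → ψ u ≡ ψ x) (line-involutive x z) ψℓℓz≡ψx ,
        λ { refl → ψℓz≢ψx (cong ψ (line-self x)) }
      from : ∀ {z} → ψ z ≡ ψ x × z ≢ x → ψ (line x z) ≢ ψ x × ψ (line x (line x z)) ≡ ψ x
      from {z} (ψz≡ψx , z≢x) =
        line-color proper (z≢x ∘ sym) (sym ψz≡ψx) ,
        subst (λ u → ψ u ≡ ψ x) (sym (line-involutive x z)) ψz≡ψx

  foreign-partner : ∀ {x z} → ψ z ≢ ψ x × ψ (line x z) ≢ ψ x →
                    ψ (line x z) ≢ ψ x × ψ (line x (line x z)) ≢ ψ x
  foreign-partner {x} {z} (ψz≢ψx , ψℓz≢ψx) =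
    ψℓz≢ψx , subst (λ u → ψ u ≢ ψ x) (sym (line-involutive x z)) ψz≢ψx

  foreign≢1 : ∀ x → foreign x ≢ 1
  foreign≢1 x foreign≡1 with count-witness (Foreign? x) (1+n≢0 ∘ trans (sym foreign≡1))
  ... | z , Fz = <-irrefl (sym foreign≡1)
                   (count-two (Foreign? x) Fz (foreign-partner Fz) (line-≢ʳ (unlike⇒≢ (proj₁ Fz)) ∘ sym))

  no-foreign⇒line-like : ∀ {a b} → foreign a ≡ 0 → ψ b ≢ ψ a → ψ (line a b) ≡ ψ a
  no-foreign⇒line-like {a} {b} foreign≡0 ψb≢ψa =
    decidable-stable (like a (line a b)) λ ψℓ≢ψa → count-zero (Foreign? a) foreign≡0 (ψb≢ψa , ψℓ≢ψa)

  foreign-line : ∀ {b a a′} → foreign b ≡ 2 → foreign a ≡ 0 → foreign a′ ≡ 0 →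
                 ψ a ≢ ψ b → ψ a′ ≢ ψ b → a ≢ a′ → line b a ≡ a′
  foreign-line {b} {a} {a′} foreign≡2 Fa≡0 Fa′≡0 ψa≢ψb ψa′≢ψb a≢a′ with line b a ≟ a′
  ... | yes ℓ≡a′ = ℓ≡a′
  ... | no ℓ≢a′ = ⊥-elim (<-irrefl (sym foreign≡2)
        (count-three (Foreign? b) (foreign-to-b Fa≡0 ψa≢ψb) (foreign-to-b Fa′≡0 ψa′≢ψb)
           (foreign-partner (foreign-to-b Fa≡0 ψa≢ψb))
           a≢a′ (line-≢ʳ (unlike⇒≢ ψa≢ψb) ∘ sym) (ℓ≢a′ ∘ sym)))
    where
    foreign-to-b : ∀ {c} → foreign c ≡ 0 → ψ c ≢ ψ b → ψ c ≢ ψ b × ψ (line b c) ≢ ψ b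
    foreign-to-b {c} Fc≡0 ψc≢ψb = ψc≢ψb , λ ψℓ≡ψb →
      ψc≢ψb (trans (sym (no-foreign⇒line-like Fc≡0 (ψc≢ψb ∘ sym)))
                   (trans (cong ψ (line-comm (unlike⇒≢ ψc≢ψb ∘ sym))) ψℓ≡ψb))

  like-point : ∀ {y} → foreign y ≡ 2 → 3 < v → ∃ λ y′ → ψ y′ ≡ ψ y × y′ ≢ y
  like-point {y} foreign≡2 3<v = count-witness (λ z → like y z ×-dec ¬? (z ≟ y)) others≢0
    where
    others≢0 : count (λ z → like y z ×-dec ¬? (z ≟ y)) ≢ 0
    others≢0 others≡0 = <⇒≢ 3<v (sym v≡3)
      where
      like≡1 : count (like y) ≡ 1
      like≡1 = trans (count-remove (like y) refl) (cong suc others≡0)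
      unlike≡2 : count (unlike y) ≡ 2
      unlike≡2 = +-cancelʳ-≡ 1 _ 2 (trans (balance y) (cong₂ _+_ like≡1 foreign≡2))
      v≡3 : v ≡ 3
      v≡3 = trans (sym (count-total (like y))) (cong₂ _+_ like≡1 unlike≡2)

module TwoColorings {v} (D : STS v) {ψ : Fin v → Fin 2} (proper : IsColoring D 2 ψ) where
  open Lines D
  open LineCounts D proper

  private
    other-color : ∀ {a b c : Fin 2} → a ≢ b → c ≢ a → c ≡ b
    other-color {0F} {0F} a≢b _ = ⊥-elim (a≢b refl)
    other-color {0F} {1F} {0F} _ c≢a = ⊥-elim (c≢a refl)
    other-color {0F} {1F} {1F} _ _ = refl
    other-color {1F} {0F} {0F} _ _ = refl
    other-color {1F} {0F} {1F} _ c≢a = ⊥-elim (c≢a refl)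
    other-color {1F} {1F} a≢b _ = ⊥-elim (a≢b refl)

  foreign-sum : ∀ {x y} → ψ x ≢ ψ y → foreign x + foreign y ≡ 2
  foreign-sum {x} {y} ψx≢ψy = +-cancelˡ-≡ (Lx + Ly) _ _ (begin
    (Lx + Ly) + (foreign x + foreign y)     ≡⟨ regroup Lx Ly (foreign x) (foreign y) ⟩
    (Lx + foreign x) + (Ly + foreign y)     ≡⟨ cong₂ _+_ (balance x) (balance y) ⟨
    (count (unlike x) + 1) + (count (unlike y) + 1)
                                            ≡⟨ cong₂ (λ a b → (a + 1) + (b + 1)) unlike-x unlike-y ⟩
    (Ly + 1) + (Lx + 1)                     ≡⟨ regroup′ Lx Ly ⟩
    (Lx + Ly) + 2                           ∎)
    where
    open ≡-Reasoning
    Lx = count (like x)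
    Ly = count (like y)
    regroup : ∀ a b c d → (a + b) + (c + d) ≡ (a + c) + (b + d)
    regroup = solve-∀
    regroup′ : ∀ a b → (b + 1) + (a + 1) ≡ (a + b) + 2
    regroup′ = solve-∀
    unlike-x : count (unlike x) ≡ Ly
    unlike-x = count-cong (unlike x) (like y) (other-color ψx≢ψy)
                 λ ψz≡ψy ψz≡ψx → ψx≢ψy (trans (sym ψz≡ψx) ψz≡ψy)
    unlike-y : count (unlike y) ≡ Lx
    unlike-y = count-cong (unlike y) (like x) (other-color (ψx≢ψy ∘ sym))
                 λ ψz≡ψx ψz≡ψy → ψx≢ψy (trans (sym ψz≡ψx) ψz≡ψy)

  unbalanced : ∀ {x y} → ψ x ≢ ψ y → foreign x ≡ 0 → foreign y ≡ 2 → 3 < v → ⊥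
  unbalanced {x} {y} ψx≢ψy Fx≡0 Fy≡2 3<v
    with like-point Fy≡2 3<v | count-witness (Foreign? y) (1+n≢0 ∘ trans (sym Fy≡2))
  ... | y′ , ψy′≡ψy , y′≢y | a , ψa≢ψy , ψa′≢ψy = y′≢y (begin
    y′
      ≡⟨ line-line (unlike⇒≢ ψa≢ψy′) ⟨
    line a (line y′ a)
      ≡⟨ cong (line a) (foreign-line (F≡2 ψy′≡ψy) (F≡0 ψa≢ψy) (F≡0 ψa′≢ψy) ψa≢ψy′ ψa′≢ψy′ a≢a′) ⟩
    line a (line y a)
      ≡⟨ line-line (unlike⇒≢ ψa≢ψy) ⟩
    y
      ∎)
    where
    open ≡-Reasoning
    F≡0 : ∀ {a} → ψ a ≢ ψ y → foreign a ≡ 0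
    F≡0 {a} ψa≢ψy = +-cancelʳ-≡ 2 _ 0 (trans (cong (foreign a +_) (sym Fy≡2)) (foreign-sum ψa≢ψy))
    F≡2 : ∀ {b} → ψ b ≡ ψ y → foreign b ≡ 2
    F≡2 {b} ψb≡ψy = +-cancelˡ-≡ 0 _ 2
      (trans (cong (_+ foreign b) (sym Fx≡0)) (foreign-sum λ ψx≡ψb → ψx≢ψy (trans ψx≡ψb ψb≡ψy)))
    ψa≢ψy′ : ψ a ≢ ψ y′
    ψa≢ψy′ rewrite ψy′≡ψy = ψa≢ψy
    ψa′≢ψy′ : ψ (line y a) ≢ ψ y′
    ψa′≢ψy′ rewrite ψy′≡ψy = ψa′≢ψy
    a≢a′ : a ≢ line y a
    a≢a′ = line-≢ʳ (unlike⇒≢ ψa≢ψy) ∘ sym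

module _ {v} (D : STS v) where

  private
    split-two : ∀ {a b} → a + b ≡ 2 → a ≢ 1 → b ≢ 1 → (a ≡ 0 × b ≡ 2) ⊎ (a ≡ 2 × b ≡ 0)
    split-two {0} refl _ _ = inj₁ (refl , refl)
    split-two {1} _ a≢1 _ = ⊥-elim (a≢1 refl)
    split-two {2} refl _ _ = inj₂ (refl , refl)
    split-two {suc (suc (suc _))} ()

    bichromatic : ∀ {k} {ψ : Fin v → Fin k} → IsColoring D k ψ → 1 < v → ∃ λ x → ∃ λ y → ψ x ≢ ψ y
    bichromatic {ψ = ψ} proper (s≤s (s≤s _)) with any? (λ y → ¬? (ψ y ≟ ψ zero))
    ... | yes (y , ψy≢ψ0) = zero , y , ψy≢ψ0 ∘ sym
    ... | no ∄y = ⊥-elim (proper (proj₁ (cover D zero (suc zero) λ ())) (ψ zero)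
                    λ w _ → decidable-stable (ψ w ≟ ψ zero) λ ψw≢ψ0 → ∄y (w , ψw≢ψ0))

  no-2-coloring : 3 < v → ¬ ∃ λ ψ → IsColoring D 2 ψ
  no-2-coloring 3<v (ψ , proper) = refute (bichromatic proper (<-trans (s≤s (s≤s z≤n)) 3<v))
    where
    open LineCounts D proper
    open TwoColorings D proper
    refute : (∃ λ x → ∃ λ y → ψ x ≢ ψ y) → ⊥
    refute (x , y , ψx≢ψy) with split-two (foreign-sum ψx≢ψy) (foreign≢1 x) (foreign≢1 y)
    ... | inj₁ (Fx≡0 , Fy≡2) = unbalanced ψx≢ψy Fx≡0 Fy≡2 3<v
    ... | inj₂ (Fx≡2 , Fy≡0) = unbalanced (ψx≢ψy ∘ sym) Fy≡0 Fx≡2 3<v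

-- Defining sets

module _ {v} (D : STS v) where

  Recolorable : (Fin v → Fin 3) → Fin v → Set
  Recolorable φ x = ∃ λ c → c ≢ φ x × Is3Coloring D (updateAt φ x (const c))

  ⊤-isMinimalDefiningSet : ∀ {φ} → Is3Coloring D φ → (∀ x → Recolorable φ x) → IsMinimalDefiningSet D φ ⊤
  ⊤-isMinimalDefiningSet {φ} φ-coloring recolorable =
    (φ-coloring , λ _ _ ψ≡φ x → ψ≡φ x ∈⊤) , not-defining
    where
    not-defining : ∀ S → S ⊂ ⊤ → ¬ IsDefiningSet D φ S
    not-defining S (_ , x , _ , x∉S) (_ , determined) with recolorable x
    ... | c , c≢φx , ψ-coloring = c≢φx (trans (sym (updateAt-updates x φ)) (determined _ ψ-coloring agrees x))
      where
      agrees : ∀ y → y ∈ S → updateAt φ x (const c) y ≡ φ y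
      agrees y y∈S = updateAt-minimal y x φ λ { refl → x∉S y∈S }

  hasDefNum-order : ∀ {φ} → Is3Coloring D φ → (∀ x → Recolorable φ x) → HasDefNum D v
  hasDefNum-order φ-coloring recolorable =
    (_ , ⊤ , ⊤-isMinimalDefiningSet φ-coloring recolorable , ∣⊤∣≡n v) , λ _ S _ → ∣p∣≤n S

  hasDefNum-≤ : ∀ {k} → HasDefNum D k → k ≤ v
  hasDefNum-≤ ((_ , S , _ , ∣S∣≡k) , _) = subst (_≤ v) ∣S∣≡k (∣p∣≤n S)

-- Steiner triple systems from block functions

record TripleSystem (Point Block : Set) : Set where
  field
    point           : Block → Fin 3 → Point
    point-injective : ∀ B {i j} → point B i ≡ point B j → i ≡ j
    join            : Point → Point → Block
    join-∋          : ∀ {p q} → p ≢ q →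
                      (∃ λ i → point (join p q) i ≡ p) × (∃ λ j → point (join p q) j ≡ q)
    join-unique     : ∀ {p q B} → p ≢ q →
                      (∃ λ i → point B i ≡ p) → (∃ λ j → point B j ≡ q) → join p q ≡ B

module FromTripleSystem {Point Block : Set} (T : TripleSystem Point Block)
                        {v b} (points : Point ↔ Fin v) (blocks : Block ↔ Fin b) where
  open TripleSystem T
  open Inverse points using ()
    renaming (to to enc; from to dec; strictlyInverseˡ to enc-dec; strictlyInverseʳ to dec-enc)
  open Inverse blocks using ()
    renaming (to to encB; from to decB; strictlyInverseˡ to encB-decB; strictlyInverseʳ to decB-encB)

  private
    enc-injective : ∀ {p q} → enc p ≡ enc q → p ≡ q
    enc-injective {p} {q} e = trans (sym (dec-enc p)) (trans (cong dec e) (dec-enc q))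

    dec-injective : ∀ {x y} → x ≢ y → dec x ≢ dec y
    dec-injective {x} {y} x≢y e = x≢y (trans (sym (enc-dec x)) (trans (cong enc e) (enc-dec y)))

  blockSet : Block → Subset v
  blockSet B = ⁅ enc (point B 0F) ⁆ ∪ (⁅ enc (point B 1F) ⁆ ∪ ⁅ enc (point B 2F) ⁆)

  ∈-blockSet⁺ : ∀ B i → enc (point B i) ∈ blockSet B
  ∈-blockSet⁺ B 0F = x∈p∪q⁺ (inj₁ (x∈⁅x⁆ _))
  ∈-blockSet⁺ B 1F = x∈p∪q⁺ {p = ⁅ enc (point B 0F) ⁆} (inj₂ (x∈p∪q⁺ (inj₁ (x∈⁅x⁆ _))))
  ∈-blockSet⁺ B 2F =
    x∈p∪q⁺ {p = ⁅ enc (point B 0F) ⁆} (inj₂ (x∈p∪q⁺ {p = ⁅ enc (point B 1F) ⁆} (inj₂ (x∈⁅x⁆ _))))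

  ∈-blockSet⁻ : ∀ B {x} → x ∈ blockSet B → ∃ λ i → point B i ≡ dec x
  ∈-blockSet⁻ B x∈ with x∈p∪q⁻ ⁅ enc (point B 0F) ⁆ _ x∈
  ... | inj₁ x∈0 = 0F , trans (sym (dec-enc _)) (cong dec (sym (x∈⁅y⁆⇒x≡y _ x∈0)))
  ... | inj₂ x∈12 with ∈⁅x,y⁆⁻ x∈12
  ...   | inj₁ refl = 1F , sym (dec-enc _)
  ...   | inj₂ refl = 2F , sym (dec-enc _)

  ∣blockSet∣≡3 : ∀ B → ∣ blockSet B ∣ ≡ 3
  ∣blockSet∣≡3 B = trans (∣⁅x⁆∪p∣≡1+∣p∣ _ _ 0∉12) (cong suc (∣⁅x,y⁆∣≡2 (distinct λ ())))
    where
    distinct : ∀ {i j} → i ≢ j → enc (point B i) ≢ enc (point B j)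
    distinct i≢j = i≢j ∘ point-injective B ∘ enc-injective
    0∉12 : enc (point B 0F) ∉ ⁅ enc (point B 1F) ⁆ ∪ ⁅ enc (point B 2F) ⁆
    0∉12 0∈ with ∈⁅x,y⁆⁻ 0∈
    ... | inj₁ e = distinct (λ ()) e
    ... | inj₂ e = distinct (λ ()) e

  private
    ∋⇒∈ : ∀ {B x} → (∃ λ i → point B i ≡ dec x) → x ∈ blockSet B
    ∋⇒∈ {B} {x} (i , e) = subst (_∈ blockSet B) (trans (cong enc e) (enc-dec x)) (∈-blockSet⁺ B i)

    covered : ∀ x y → x ≢ y → ∃ λ j → x ∈ blockSet (decB j) × y ∈ blockSet (decB j)
    covered x y x≢y with join-∋ (dec-injective x≢y)
    ... | x∈J , y∈J =
      encB J , subst (λ B → x ∈ blockSet B × y ∈ blockSet B) (sym (decB-encB J)) (∋⇒∈ x∈J , ∋⇒∈ y∈J)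
      where J = join (dec x) (dec y)

    covered-once : ∀ x y i j → x ≢ y → x ∈ blockSet (decB i) → y ∈ blockSet (decB i) →
                   x ∈ blockSet (decB j) → y ∈ blockSet (decB j) → i ≡ j
    covered-once x y i j x≢y x∈i y∈i x∈j y∈j = begin
      i                            ≡⟨ encB-decB i ⟨
      encB (decB i)                ≡⟨ cong encB (joins x∈i y∈i) ⟨
      encB (join (dec x) (dec y))  ≡⟨ cong encB (joins x∈j y∈j) ⟩
      encB (decB j)                ≡⟨ encB-decB j ⟩
      j                            ∎
      where
      open ≡-Reasoning
      joins : ∀ {l} → x ∈ blockSet (decB l) → y ∈ blockSet (decB l) → join (dec x) (dec y) ≡ decB l
      joins x∈l y∈l = join-unique (dec-injective x≢y) (∈-blockSet⁻ _ x∈l) (∈-blockSet⁻ _ y∈l)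

  sts : STS v
  sts = record
    { b = b ; block = blockSet ∘ decB ; size3 = ∣blockSet∣≡3 ∘ decB ; cover = covered ; unique = covered-once }

  sts-coloring : ∀ {k} (ψ : Fin v → Fin k) → (∀ B c → ¬ (∀ i → ψ (enc (point B i)) ≡ c)) →
                 IsColoring sts k ψ
  sts-coloring ψ proper j c mono = proper (decB j) c λ i → mono _ (∈-blockSet⁺ (decB j) i)

  transported-coloring : ∀ {k} (κ : Point → Fin k) → (∀ B c → ¬ (∀ i → κ (point B i) ≡ c)) →
                         IsColoring sts k (κ ∘ dec)
  transported-coloring κ proper =
    sts-coloring (κ ∘ dec) λ B c mono → proper B c λ i → trans (cong κ (sym (dec-enc _))) (mono i)

  recolored-coloring : ∀ {k} (κ : Point → Fin k) (new : Fin k → Fin k) →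
    (∀ B c → ¬ (∀ i → κ (point B i) ≡ c)) →
    (∀ B j c → (∀ i → i ≢ j → κ (point B i) ≡ c) → new (κ (point B j)) ≢ c) →
    ∀ x → IsColoring sts k (updateAt (κ ∘ dec) x (const (new (κ (dec x)))))
  recolored-coloring κ new proper raised-proper x =
    sts-coloring ψ λ B c mono → by-cases B c mono (any? λ j → enc (point B j) ≟ x)
    where
    ψ = updateAt (κ ∘ dec) x (const (new (κ (dec x))))
    unchanged : ∀ p → enc p ≢ x → ψ (enc p) ≡ κ p
    unchanged p ≢x = trans (updateAt-minimal _ x (κ ∘ dec) ≢x) (cong κ (dec-enc p))
    by-cases : ∀ B c → (∀ i → ψ (enc (point B i)) ≡ c) → Dec (∃ λ j → enc (point B j) ≡ x) → ⊥
    by-cases B c mono (yes (j , refl)) = raised-proper B j c others raised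
      where
      others : ∀ i → i ≢ j → κ (point B i) ≡ c
      others i i≢j = trans (sym (unchanged _ (i≢j ∘ point-injective B ∘ enc-injective))) (mono i)
      raised : new (κ (point B j)) ≡ c
      raised = trans (cong (new ∘ κ) (sym (dec-enc (point B j))))
                     (trans (sym (updateAt-updates (enc (point B j)) (κ ∘ dec))) (mono j))
    by-cases B c mono (no ∄j) = proper B c λ i → trans (sym (unchanged _ λ e → ∄j (i , e))) (mono i)

-- Arithmetic modulo m = 2n + 1

module Congruence (n : ℕ) where

  m : ℕ
  m = suc (n + n)

  infix 4 _≋_
  record _≋_ (a b : ℕ) : Set where
    constructor mod-≡
    field %-≡ : a % m ≡ b % m

  ≋-refl : ∀ {a} → a ≋ a
  ≋-refl = mod-≡ refl

  ≋-sym : ∀ {a b} → a ≋ b → b ≋ a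
  ≋-sym (mod-≡ e) = mod-≡ (sym e)

  ≋-trans : ∀ {a b c} → a ≋ b → b ≋ c → a ≋ c
  ≋-trans (mod-≡ e) (mod-≡ e′) = mod-≡ (trans e e′)

  ≋-+ : ∀ {a b c d} → a ≋ b → c ≋ d → a + c ≋ b + d
  ≋-+ {a} {b} {c} {d} (mod-≡ a≋b) (mod-≡ c≋d) = mod-≡ (begin
    (a + c) % m              ≡⟨ %-distribˡ-+ a c m ⟩
    (a % m + c % m) % m      ≡⟨ cong₂ (λ u w → (u + w) % m) a≋b c≋d ⟩
    (b % m + d % m) % m      ≡⟨ %-distribˡ-+ b d m ⟨
    (b + d) % m              ∎)
    where open ≡-Reasoning

  ≋-*ʳ : ∀ {a b} c → a ≋ b → a * c ≋ b * c
  ≋-*ʳ {a} {b} c (mod-≡ a≋b) = mod-≡ (begin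
    (a * c) % m              ≡⟨ %-distribˡ-* a c m ⟩
    (a % m * (c % m)) % m    ≡⟨ cong (λ u → (u * (c % m)) % m) a≋b ⟩
    (b % m * (c % m)) % m    ≡⟨ %-distribˡ-* b c m ⟨
    (b * c) % m              ∎)
    where open ≡-Reasoning

  ≋-*ˡ : ∀ {a b} c → a ≋ b → c * a ≋ c * b
  ≋-*ˡ {a} {b} c a≋b = subst₂ _≋_ (*-comm a c) (*-comm b c) (≋-*ʳ c a≋b)

  ≋-multiple : ∀ {a b} q → a ≡ b + q * m → a ≋ b
  ≋-multiple {b = b} q a≡b+qm = mod-≡ (trans (cong (_% m) a≡b+qm) ([m+kn]%n≡m%n b q m))

  ≋-cancelˡ : ∀ c {a b} → c + a ≋ c + b → a ≋ b
  ≋-cancelˡ c {a} {b} e = ≋-trans (≋-sym (shift a)) (≋-trans (≋-+ e ≋-refl) (shift b))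
    where
    shift : ∀ a → c + a + (n + n) * c ≋ a
    shift a = ≋-multiple c (lemma c a n)
      where
      lemma : ∀ c a n → c + a + (n + n) * c ≡ a + c * suc (n + n)
      lemma = solve-∀

  ≡⇒≋ : ∀ {a b} → a ≡ b → a ≋ b
  ≡⇒≋ refl = ≋-refl

  ≋-small : ∀ {a b} → a < m → b < m → a ≋ b → a ≡ b
  ≋-small a<m b<m (mod-≡ a≋b) = trans (sym (m<n⇒m%n≡m a<m)) (trans a≋b (m<n⇒m%n≡m b<m))

  ≋-% : ∀ a → a % m ≋ a
  ≋-% a = mod-≡ (m%n%n≡m%n a m)

  ≋-setoid : Setoid _ _
  ≋-setoid = record
    { Carrier = ℕ ; _≈_ = _≋_ ; isEquivalence = record { refl = ≋-refl ; sym = ≋-sym ; trans = ≋-trans } }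

  [_] : ℕ → Fin m
  [ a ] = a mod m

  toℕ-[] : ∀ a → toℕ [ a ] ≡ a % m
  toℕ-[] a = toℕ-fromℕ< (m%n<n a m)

  ≋-[] : ∀ a → toℕ [ a ] ≋ a
  ≋-[] a = ≋-trans (mod-≡ (cong (_% m) (toℕ-[] a))) (≋-% a)

  fin-≋ : ∀ {x y : Fin m} → toℕ x ≋ toℕ y → x ≡ y
  fin-≋ {x} {y} e = toℕ-injective (≋-small (toℕ<n x) (toℕ<n y) e)

  []-≋ : ∀ {x : Fin m} {a} → toℕ x ≋ a → x ≡ [ a ]
  []-≋ {x} {a} e = fin-≋ (≋-trans e (≋-sym (≋-[] a)))

  ≋0⇒≡m : ∀ {a} → 0 < a → a < m + m → a ≋ 0 → a ≡ m
  ≋0⇒≡m {a} 0<a a<2m a≋0 with a <? m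
  ... | yes a<m = ⊥-elim (<⇒≢ 0<a (sym (≋-small a<m (s≤s z≤n) a≋0)))
  ... | no a≮m = trans (sym (m+[n∸m]≡n m≤a)) (trans (cong (m +_) a∸m≡0) (+-identityʳ m))
    where
    m≤a = ≮⇒≥ a≮m
    a≡a∸m+m : a ≡ (a ∸ m) + 1 * m
    a≡a∸m+m = trans (sym (m∸n+n≡m m≤a)) (cong ((a ∸ m) +_) (sym (+-identityʳ m)))
    a∸m≡0 : a ∸ m ≡ 0
    a∸m≡0 = ≋-small (subst (a ∸ m <_) (m+n∸n≡m m m) (∸-monoˡ-< a<2m m≤a)) (s≤s z≤n)
              (≋-trans (≋-sym (≋-multiple 1 a≡a∸m+m)) a≋0)

module Residues (n : ℕ) where
  open Congruence n
  open SetoidReasoning ≋-setoid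

  -- Negation and halving are multiplication by n + n ≡ −1 and suc n ≡ 1/2 (mod m);
  -- halfGap x y is the residue of (y − x)/2, and gap x y that of x − y.
  _⊕_ _⊖_ : Fin m → ℕ → Fin m
  z ⊕ t = [ toℕ z + t ]
  z ⊖ t = [ toℕ z + (n + n) * t ]

  midpoint : Fin m → Fin m → Fin m
  midpoint x y = [ (toℕ x + toℕ y) * suc n ]

  halfGap gap : Fin m → Fin m → ℕ
  halfGap x y = (toℕ y + (n + n) * toℕ x) * suc n % m
  gap x y = (toℕ x + (n + n) * toℕ y) % m

  midpoint-comm : ∀ x y → midpoint x y ≡ midpoint y x
  midpoint-comm x y = cong (λ u → [ u * suc n ]) (+-comm (toℕ x) (toℕ y))

  halfGap-≋ : ∀ x y → halfGap x y ≋ (toℕ y + (n + n) * toℕ x) * suc n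
  halfGap-≋ x y = ≋-% ((toℕ y + (n + n) * toℕ x) * suc n)

  gap-≋ : ∀ x y → gap x y ≋ toℕ x + (n + n) * toℕ y
  gap-≋ x y = ≋-% (toℕ x + (n + n) * toℕ y)

  midpoint-⊕ : ∀ x y → midpoint x y ⊕ halfGap x y ≡ y
  midpoint-⊕ x y = fin-≋ (begin
    toℕ (midpoint x y ⊕ halfGap x y)              ≈⟨ ≋-[] _ ⟩
    toℕ (midpoint x y) + halfGap x y              ≈⟨ ≋-+ (≋-[] ((X + Y) * suc n)) (halfGap-≋ x y) ⟩
    (X + Y) * suc n + (Y + (n + n) * X) * suc n   ≈⟨ ≋-multiple (X * suc n + Y) (identity n X Y) ⟩
    Y                                             ∎)
    where
    X = toℕ x
    Y = toℕ y
    identity : ∀ n X Y → (X + Y) * suc n + (Y + (n + n) * X) * suc n ≡ Y + (X * suc n + Y) * suc (n + n)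
    identity = solve-∀

  midpoint-⊖ : ∀ x y → midpoint x y ⊖ halfGap x y ≡ x
  midpoint-⊖ x y = fin-≋ (begin
    toℕ (midpoint x y ⊖ halfGap x y)
      ≈⟨ ≋-[] _ ⟩
    toℕ (midpoint x y) + (n + n) * halfGap x y
      ≈⟨ ≋-+ (≋-[] ((X + Y) * suc n)) (≋-*ˡ (n + n) (halfGap-≋ x y)) ⟩
    (X + Y) * suc n + (n + n) * ((Y + (n + n) * X) * suc n)
      ≈⟨ ≋-multiple (X * n * suc (n + n) + Y * suc n) (identity n X Y) ⟩
    X
      ∎)
    where
    X = toℕ x
    Y = toℕ y
    identity : ∀ n X Y → (X + Y) * suc n + (n + n) * ((Y + (n + n) * X) * suc n) ≡
                         X + (X * n * suc (n + n) + Y * suc n) * suc (n + n)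
    identity = solve-∀

  ⊕-gap : ∀ x y → y ⊕ gap x y ≡ x
  ⊕-gap x y = fin-≋ (begin
    toℕ (y ⊕ gap x y)          ≈⟨ ≋-[] _ ⟩
    Y + gap x y                ≈⟨ ≋-+ (≋-refl {Y}) (gap-≋ x y) ⟩
    Y + (X + (n + n) * Y)      ≈⟨ ≋-multiple Y (identity n X Y) ⟩
    X                          ∎)
    where
    X = toℕ x
    Y = toℕ y
    identity : ∀ n X Y → Y + (X + (n + n) * Y) ≡ X + Y * suc (n + n)
    identity = solve-∀

  halfGap≢0 : ∀ {x y} → x ≢ y → halfGap x y ≢ 0
  halfGap≢0 {x} {y} x≢y halfGap≡0 = x≢y (sym (fin-≋ (begin
    Y                                         ≈⟨ ≋-multiple (X + Y + (n + n) * X) (identity n X Y) ⟨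
    (Y + (n + n) * X) * suc n * 2 + X         ≈⟨ ≋-+ (≋-*ʳ 2 scaled≋0) (≋-refl {X}) ⟩
    X                                         ∎)))
    where
    X = toℕ x
    Y = toℕ y
    scaled≋0 : (Y + (n + n) * X) * suc n ≋ 0
    scaled≋0 = ≋-trans (≋-sym (halfGap-≋ x y)) (≡⇒≋ halfGap≡0)
    identity : ∀ n X Y → (Y + (n + n) * X) * suc n * 2 + X ≡ Y + (X + Y + (n + n) * X) * suc (n + n)
    identity = solve-∀

  gap≢0 : ∀ {x y} → x ≢ y → gap x y ≢ 0
  gap≢0 {x} {y} x≢y gap≡0 = x≢y (fin-≋ (begin
    X                          ≈⟨ ≋-multiple Y (identity n X Y) ⟨
    X + (n + n) * Y + Y        ≈⟨ ≋-+ diff≋0 (≋-refl {Y}) ⟩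
    Y                          ∎))
    where
    X = toℕ x
    Y = toℕ y
    diff≋0 : X + (n + n) * Y ≋ 0
    diff≋0 = ≋-trans (≋-sym (gap-≋ x y)) (≡⇒≋ gap≡0)
    identity : ∀ n X Y → X + (n + n) * Y + Y ≡ X + Y * suc (n + n)
    identity = solve-∀

  ⊕-complement : ∀ z {s t} → s + t ≡ m → z ⊕ s ≡ z ⊖ t
  ⊕-complement z {s} {t} s+t≡m = fin-≋ (begin
    toℕ (z ⊕ s)              ≈⟨ ≋-[] _ ⟩
    Z + s                    ≈⟨ ≋-multiple t refl ⟨
    Z + s + t * m            ≡⟨ identity n Z s t ⟩
    Z + (n + n) * t + 1 * (t + s)
                             ≡⟨ cong (λ u → Z + (n + n) * t + 1 * u) (trans (+-comm t s) s+t≡m) ⟩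
    Z + (n + n) * t + 1 * m  ≈⟨ ≋-multiple 1 refl ⟩
    Z + (n + n) * t          ≈⟨ ≋-[] _ ⟨
    toℕ (z ⊖ t)              ∎)
    where
    Z = toℕ z
    identity : ∀ n Z s t → Z + s + t * suc (n + n) ≡ Z + (n + n) * t + 1 * (t + s)
    identity = solve-∀

  gap<m : ∀ x y → gap x y < m
  gap<m x y = m%n<n (toℕ x + (n + n) * toℕ y) m

  halfGap<m : ∀ x y → halfGap x y < m
  halfGap<m x y = m%n<n ((toℕ y + (n + n) * toℕ x) * suc n) m

  radius : Fin n → ℕ
  radius d = suc (toℕ d)

  radius≤n : ∀ d → radius d ≤ n
  radius≤n d = toℕ<n d

  radius<m : ∀ d → radius d < m
  radius<m d = s≤s (≤-trans (radius≤n d) (m≤m+n n n))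

  radius≉0 : ∀ d → radius d ≋ 0 → ⊥
  radius≉0 d r≋0 with ≋-small (radius<m d) (s≤s z≤n) r≋0
  ... | ()

  module Triangle (z : Fin m) (d : Fin n) where
    private
      Z = toℕ z
      R = radius d
      ≋-⊖ : toℕ (z ⊖ R) ≋ Z + (n + n) * R
      ≋-⊖ = ≋-[] _
      ≋-⊕ : toℕ (z ⊕ R) ≋ Z + R
      ≋-⊕ = ≋-[] _
      0<+R : ∀ a → 0 < a + R
      0<+R a = ≤-trans (s≤s z≤n) (m≤n+m R a)

    ⊖≢⊕ : z ⊖ R ≢ z ⊕ R
    ⊖≢⊕ e = radius≉0 d (begin
      R                ≈⟨ ≋-multiple R (identity₁ n R) ⟨
      (R + R) * suc n  ≈⟨ ≋-*ʳ (suc n) 2R≋0 ⟩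
      0                ∎)
      where
      2nR≋R : (n + n) * R ≋ R
      2nR≋R = ≋-cancelˡ Z (begin
        Z + (n + n) * R  ≈⟨ ≋-⊖ ⟨
        toℕ (z ⊖ R)      ≡⟨ cong toℕ e ⟩
        toℕ (z ⊕ R)      ≈⟨ ≋-⊕ ⟩
        Z + R            ∎)
      identity₁ : ∀ n R → (R + R) * suc n ≡ R + R * suc (n + n)
      identity₁ = solve-∀
      identity₂ : ∀ n R → (n + n) * R + R ≡ 0 + R * suc (n + n)
      identity₂ = solve-∀
      2R≋0 : R + R ≋ 0
      2R≋0 = ≋-trans (≋-sym (≋-+ 2nR≋R (≋-refl {R}))) (≋-multiple R (identity₂ n R))

    ⊖≢centre : z ⊖ R ≢ z
    ⊖≢centre e = radius≉0 d (begin
      R                ≈⟨ ≋-+ 2nR≋0 (≋-refl {R}) ⟨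
      (n + n) * R + R  ≈⟨ ≋-multiple R (identity n R) ⟩
      0                ∎)
      where
      2nR≋0 : (n + n) * R ≋ 0
      2nR≋0 = ≋-cancelˡ Z (begin
        Z + (n + n) * R  ≈⟨ ≋-⊖ ⟨
        toℕ (z ⊖ R)      ≡⟨ cong toℕ e ⟩
        Z                ≡⟨ +-identityʳ Z ⟨
        Z + 0            ∎)
      identity : ∀ n R → (n + n) * R + R ≡ 0 + R * suc (n + n)
      identity = solve-∀

    ⊕≢centre : z ⊕ R ≢ z
    ⊕≢centre e = radius≉0 d (≋-cancelˡ Z (begin
      Z + R            ≈⟨ ≋-⊕ ⟨
      toℕ (z ⊕ R)      ≡⟨ cong toℕ e ⟩
      Z                ≡⟨ +-identityʳ Z ⟨
      Z + 0            ∎))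

    midpoint-⊖⊕ : midpoint (z ⊖ R) (z ⊕ R) ≡ z
    midpoint-⊖⊕ = sym ([]-≋ (begin
      Z                                      ≈⟨ ≋-multiple (Z + R * suc n) (identity n Z R) ⟨
      (Z + (n + n) * R + (Z + R)) * suc n    ≈⟨ ≋-*ʳ (suc n) (≋-+ ≋-⊖ ≋-⊕) ⟨
      (toℕ (z ⊖ R) + toℕ (z ⊕ R)) * suc n    ∎))
      where
      identity : ∀ n Z R → (Z + (n + n) * R + (Z + R)) * suc n ≡ Z + (Z + R * suc n) * suc (n + n)
      identity = solve-∀

    halfGap-⊖⊕ : halfGap (z ⊖ R) (z ⊕ R) ≡ R
    halfGap-⊖⊕ = ≋-small (halfGap<m (z ⊖ R) (z ⊕ R)) (radius<m d) (begin
      halfGap (z ⊖ R) (z ⊕ R)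
        ≈⟨ halfGap-≋ (z ⊖ R) (z ⊕ R) ⟩
      (toℕ (z ⊕ R) + (n + n) * toℕ (z ⊖ R)) * suc n
        ≈⟨ ≋-*ʳ (suc n) (≋-+ ≋-⊕ (≋-*ˡ (n + n) ≋-⊖)) ⟩
      (Z + R + (n + n) * (Z + (n + n) * R)) * suc n
        ≈⟨ ≋-multiple (Z * suc n + R * n * suc (n + n)) (identity n Z R) ⟩
      R
        ∎)
      where
      identity : ∀ n Z R → (Z + R + (n + n) * (Z + (n + n) * R)) * suc n ≡
                           R + (Z * suc n + R * n * suc (n + n)) * suc (n + n)
      identity = solve-∀

    halfGap-⊕⊖ : halfGap (z ⊕ R) (z ⊖ R) + R ≡ m
    halfGap-⊕⊖ = ≋0⇒≡m (0<+R _) (+-mono-< (halfGap<m (z ⊕ R) (z ⊖ R)) (radius<m d)) (begin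
      halfGap (z ⊕ R) (z ⊖ R) + R
        ≈⟨ ≋-+ (halfGap-≋ (z ⊕ R) (z ⊖ R)) (≋-refl {R}) ⟩
      (toℕ (z ⊖ R) + (n + n) * toℕ (z ⊕ R)) * suc n + R
        ≈⟨ ≋-+ (≋-*ʳ (suc n) (≋-+ ≋-⊖ (≋-*ˡ (n + n) ≋-⊕))) (≋-refl {R}) ⟩
      (Z + (n + n) * R + (n + n) * (Z + R)) * suc n + R
        ≈⟨ ≋-multiple (Z * suc n + R * suc (n + n)) (identity n Z R) ⟩
      0
        ∎)
      where
      identity : ∀ n Z R → (Z + (n + n) * R + (n + n) * (Z + R)) * suc n + R ≡
                           0 + (Z * suc n + R * suc (n + n)) * suc (n + n)
      identity = solve-∀

    gap-⊖ : gap (z ⊖ R) z + R ≡ m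
    gap-⊖ = ≋0⇒≡m (0<+R _) (+-mono-< (gap<m (z ⊖ R) z) (radius<m d)) (begin
      gap (z ⊖ R) z + R                  ≈⟨ ≋-+ (gap-≋ (z ⊖ R) z) (≋-refl {R}) ⟩
      toℕ (z ⊖ R) + (n + n) * Z + R      ≈⟨ ≋-+ (≋-+ ≋-⊖ (≋-refl {(n + n) * Z})) (≋-refl {R}) ⟩
      Z + (n + n) * R + (n + n) * Z + R  ≈⟨ ≋-multiple (Z + R) (identity n Z R) ⟩
      0                                  ∎)
      where
      identity : ∀ n Z R → Z + (n + n) * R + (n + n) * Z + R ≡ 0 + (Z + R) * suc (n + n)
      identity = solve-∀

    gap-⊕ : gap (z ⊕ R) z ≡ R
    gap-⊕ = ≋-small (gap<m (z ⊕ R) z) (radius<m d) (begin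
      gap (z ⊕ R) z                ≈⟨ gap-≋ (z ⊕ R) z ⟩
      toℕ (z ⊕ R) + (n + n) * Z    ≈⟨ ≋-+ ≋-⊕ (≋-refl {(n + n) * Z}) ⟩
      Z + R + (n + n) * Z          ≈⟨ ≋-multiple Z (identity n Z R) ⟩
      R                            ∎)
      where
      identity : ∀ n Z R → Z + R + (n + n) * Z ≡ R + Z * suc (n + n)
      identity = solve-∀

-- The Bose triple system on ℤ₃ × ℤₘ

next : Fin 3 → Fin 3
next 0F = 1F
next 1F = 2F
next 2F = 0F

next-≢ : ∀ i → next i ≢ i
next-≢ 0F ()
next-≢ 1F ()
next-≢ 2F ()

next²-≢ : ∀ i → next (next i) ≢ i
next²-≢ 0F ()
next²-≢ 1F ()
next²-≢ 2F ()

≢∧≢next⇒≡next : ∀ {a b} → a ≢ b → b ≢ next a → a ≡ next b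
≢∧≢next⇒≡next {0F} {0F} a≢b _ = ⊥-elim (a≢b refl)
≢∧≢next⇒≡next {0F} {1F} _ b≢a⁺ = ⊥-elim (b≢a⁺ refl)
≢∧≢next⇒≡next {0F} {2F} _ _ = refl
≢∧≢next⇒≡next {1F} {0F} _ _ = refl
≢∧≢next⇒≡next {1F} {1F} a≢b _ = ⊥-elim (a≢b refl)
≢∧≢next⇒≡next {1F} {2F} _ b≢a⁺ = ⊥-elim (b≢a⁺ refl)
≢∧≢next⇒≡next {2F} {0F} _ b≢a⁺ = ⊥-elim (b≢a⁺ refl)
≢∧≢next⇒≡next {2F} {1F} _ _ = refl
≢∧≢next⇒≡next {2F} {2F} a≢b _ = ⊥-elim (a≢b refl)

module Bose (n : ℕ) {{_ : NonZero n}} where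
  open Congruence n
  open Residues n

  Point : Set
  Point = Fin 3 × Fin m

  Block : Set
  Block = Fin m ⊎ (Fin m × Fin n × Fin 3)

  pattern column x = inj₁ x
  pattern triangle z d i = inj₂ (z , d , i)

  point : Block → Fin 3 → Point
  point (column x) i = i , x
  point (triangle z d i) 0F = i , z ⊖ radius d
  point (triangle z d i) 1F = i , z ⊕ radius d
  point (triangle z d i) 2F = next i , z

  infix 4 _∈ᵇ_
  _∈ᵇ_ : Point → Block → Set
  p ∈ᵇ B = ∃ λ i → point B i ≡ p

  triangleAt : Fin m → ℕ → Fin 3 → Block
  triangleAt z t i with t ≤? n
  ... | yes _ = triangle z ((t ∸ 1) mod n) i
  ... | no _  = triangle z ((m ∸ t ∸ 1) mod n) i

  radius-mod : ∀ {t} → 1 ≤ t → t ≤ n → radius ((t ∸ 1) mod n) ≡ t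
  radius-mod {suc t} _ t<n = cong suc (trans (toℕ-fromℕ< (m%n<n t n)) (m<n⇒m%n≡m t<n))

  mod-radius : ∀ d → (radius d ∸ 1) mod n ≡ d
  mod-radius d = toℕ-injective (trans (toℕ-fromℕ< (m%n<n (toℕ d) n)) (m<n⇒m%n≡m (toℕ<n d)))

  triangleAt-∋ : ∀ z {t} i → 1 ≤ t → t < m →
                 (i , z ⊖ t) ∈ᵇ triangleAt z t i × (i , z ⊕ t) ∈ᵇ triangleAt z t i ×
                 point (triangleAt z t i) 2F ≡ (next i , z)
  triangleAt-∋ z {t} i 1≤t t<m with t ≤? n
  ... | yes t≤n = (0F , cong (λ r → i , z ⊖ r) (radius-mod 1≤t t≤n)) ,
                  (1F , cong (λ r → i , z ⊕ r) (radius-mod 1≤t t≤n)) , refl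
  ... | no t≰n  = (1F , cong (i ,_) (trans (cong (z ⊕_) r≡m∸t) (⊕-complement z (m∸n+n≡m (<⇒≤ t<m))))) ,
                  (0F , cong (i ,_) (trans (cong (z ⊖_) r≡m∸t) (sym (⊕-complement z (m+[n∸m]≡n (<⇒≤ t<m)))))) ,
                  refl
    where
    m∸t≤n : m ∸ t ≤ n
    m∸t≤n = subst (m ∸ t ≤_) (m+n∸m≡n (suc n) n) (∸-monoʳ-≤ m (≰⇒> t≰n))
    r≡m∸t : radius ((m ∸ t ∸ 1) mod n) ≡ m ∸ t
    r≡m∸t = radius-mod (m<n⇒0<n∸m t<m) m∸t≤n

  triangleAt-radius : ∀ z {t} d i → t ≡ radius d → triangleAt z t i ≡ triangle z d i
  triangleAt-radius z {t} d i t≡r with t ≤? n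
  ... | yes _ = cong (λ e → triangle z e i) (trans (cong (λ u → (u ∸ 1) mod n) t≡r) (mod-radius d))
  ... | no t≰n = ⊥-elim (t≰n (subst (_≤ n) (sym t≡r) (radius≤n d)))

  triangleAt-coradius : ∀ z {t} d i → t + radius d ≡ m → triangleAt z t i ≡ triangle z d i
  triangleAt-coradius z {t} d i t+r≡m with t ≤? n
  ... | yes t≤n = ⊥-elim (<-irrefl t+r≡m (s≤s (+-mono-≤ t≤n (radius≤n d))))
  ... | no _ = cong (λ e → triangle z e i) (trans (cong (λ u → (u ∸ 1) mod n) m∸t≡r) (mod-radius d))
    where
    m∸t≡r : m ∸ t ≡ radius d
    m∸t≡r = trans (cong (_∸ t) (sym t+r≡m)) (m+n∸m≡n t (radius d))

  join : Point → Point → Block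
  join (a , x) (b , y) with x ≟ y | a ≟ b | b ≟ next a
  ... | yes _ | _     | _     = column x
  ... | no _  | yes _ | _     = triangleAt (midpoint x y) (halfGap x y) a
  ... | no _  | no _  | yes _ = triangleAt y (gap x y) a
  ... | no _  | no _  | no _  = triangleAt x (gap y x) b

  join-column : ∀ a b x → join (a , x) (b , x) ≡ column x
  join-column a b x with x ≟ x
  ... | yes _ = refl
  ... | no x≢x = ⊥-elim (x≢x refl)

  join-level : ∀ a {x y} → x ≢ y → join (a , x) (a , y) ≡ triangleAt (midpoint x y) (halfGap x y) a
  join-level a {x} {y} x≢y with x ≟ y | a ≟ a
  ... | yes x≡y | _ = ⊥-elim (x≢y x≡y)
  ... | no _ | yes _ = refl
  ... | no _ | no a≢a = ⊥-elim (a≢a refl)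

  join-up : ∀ a {x y} → x ≢ y → join (a , x) (next a , y) ≡ triangleAt y (gap x y) a
  join-up a {x} {y} x≢y with x ≟ y | a ≟ next a | next a ≟ next a
  ... | yes x≡y | _ | _ = ⊥-elim (x≢y x≡y)
  ... | no _ | yes a≡a⁺ | _ = ⊥-elim (next-≢ a (sym a≡a⁺))
  ... | no _ | no _ | yes _ = refl
  ... | no _ | no _ | no a⁺≢a⁺ = ⊥-elim (a⁺≢a⁺ refl)

  join-down : ∀ b {x y} → x ≢ y → join (next b , x) (b , y) ≡ triangleAt x (gap y x) b
  join-down b {x} {y} x≢y with x ≟ y | next b ≟ b | b ≟ next (next b)
  ... | yes x≡y | _ | _ = ⊥-elim (x≢y x≡y)
  ... | no _ | yes b⁺≡b | _ = ⊥-elim (next-≢ b b⁺≡b)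
  ... | no _ | no _ | yes b≡b⁺⁺ = ⊥-elim (next²-≢ b (sym b≡b⁺⁺))
  ... | no _ | no _ | no _ = refl

  point-injective : ∀ B {i j} → point B i ≡ point B j → i ≡ j
  point-injective (column x) e = cong proj₁ e
  point-injective (triangle z d k) {0F} {0F} _ = refl
  point-injective (triangle z d k) {0F} {1F} e = ⊥-elim (Triangle.⊖≢⊕ z d (cong proj₂ e))
  point-injective (triangle z d k) {0F} {2F} e = ⊥-elim (next-≢ k (sym (cong proj₁ e)))
  point-injective (triangle z d k) {1F} {0F} e = ⊥-elim (Triangle.⊖≢⊕ z d (sym (cong proj₂ e)))
  point-injective (triangle z d k) {1F} {1F} _ = refl
  point-injective (triangle z d k) {1F} {2F} e = ⊥-elim (next-≢ k (sym (cong proj₁ e)))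
  point-injective (triangle z d k) {2F} {0F} e = ⊥-elim (next-≢ k (cong proj₁ e))
  point-injective (triangle z d k) {2F} {1F} e = ⊥-elim (next-≢ k (cong proj₁ e))
  point-injective (triangle z d k) {2F} {2F} _ = refl

  join-∋ : ∀ {p q} → p ≢ q → p ∈ᵇ join p q × q ∈ᵇ join p q
  join-∋ {a , x} {b , y} p≢q with x ≟ y | a ≟ b | b ≟ next a
  ... | yes refl | _ | _ = (a , refl) , (b , refl)
  ... | no x≢y | yes refl | _ =
    subst (λ u → (a , u) ∈ᵇ T) (midpoint-⊖ x y) (proj₁ members) ,
    subst (λ u → (a , u) ∈ᵇ T) (midpoint-⊕ x y) (proj₁ (proj₂ members))
    where
    T = triangleAt (midpoint x y) (halfGap x y) a
    members = triangleAt-∋ (midpoint x y) a (n≢0⇒n>0 (halfGap≢0 x≢y)) (halfGap<m x y)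
  ... | no x≢y | no _ | yes refl =
    subst (λ u → (a , u) ∈ᵇ T) (⊕-gap x y) (proj₁ (proj₂ members)) , (2F , proj₂ (proj₂ members))
    where
    T = triangleAt y (gap x y) a
    members = triangleAt-∋ y a (n≢0⇒n>0 (gap≢0 x≢y)) (gap<m x y)
  ... | no x≢y | no a≢b | no b≢a⁺ with ≢∧≢next⇒≡next a≢b b≢a⁺
  ...   | refl =
    (2F , proj₂ (proj₂ members)) , subst (λ u → (b , u) ∈ᵇ T) (⊕-gap y x) (proj₁ (proj₂ members))
    where
    T = triangleAt x (gap y x) b
    members = triangleAt-∋ x b (n≢0⇒n>0 (gap≢0 (x≢y ∘ sym))) (gap<m y x)

  join-unique : ∀ {p q B} → p ≢ q → p ∈ᵇ B → q ∈ᵇ B → join p q ≡ B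
  join-unique {B = column x} _ (i , refl) (j , refl) = join-column i j x
  join-unique {B = triangle z d k} p≢q (i , refl) (j , refl) =
    on-triangle i j (p≢q ∘ cong (point (triangle z d k)))
    where
    open Triangle z d
    R = radius d
    via-midpoint : ∀ {x y} → x ≢ y → midpoint x y ≡ z → triangleAt z (halfGap x y) k ≡ triangle z d k →
                   join (k , x) (k , y) ≡ triangle z d k
    via-midpoint {x} {y} x≢y mid≡z at-z =
      trans (join-level k x≢y) (trans (cong (λ w → triangleAt w (halfGap x y) k) mid≡z) at-z)
    on-triangle : ∀ i j → i ≢ j → join (point (triangle z d k) i) (point (triangle z d k) j) ≡ triangle z d k
    on-triangle 0F 0F i≢j = ⊥-elim (i≢j refl)
    on-triangle 1F 1F i≢j = ⊥-elim (i≢j refl)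
    on-triangle 2F 2F i≢j = ⊥-elim (i≢j refl)
    on-triangle 0F 1F _ = via-midpoint ⊖≢⊕ midpoint-⊖⊕ (triangleAt-radius z d k halfGap-⊖⊕)
    on-triangle 1F 0F _ = via-midpoint (⊖≢⊕ ∘ sym) (trans (midpoint-comm (z ⊕ R) (z ⊖ R)) midpoint-⊖⊕)
                                       (triangleAt-coradius z d k halfGap-⊕⊖)
    on-triangle 0F 2F _ = trans (join-up k ⊖≢centre) (triangleAt-coradius z d k gap-⊖)
    on-triangle 1F 2F _ = trans (join-up k ⊕≢centre) (triangleAt-radius z d k gap-⊕)
    on-triangle 2F 0F _ = trans (join-down k (⊖≢centre ∘ sym)) (triangleAt-coradius z d k gap-⊖)
    on-triangle 2F 1F _ = trans (join-down k (⊕≢centre ∘ sym)) (triangleAt-radius z d k gap-⊕)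

  level : Point → Fin 3
  level = proj₁

  level-proper : ∀ B c → ¬ (∀ i → level (point B i) ≡ c)
  level-proper (column x) c mono with trans (mono 0F) (sym (mono 1F))
  ... | ()
  level-proper (triangle z d k) c mono = next-≢ k (trans (mono 2F) (sym (mono 0F)))

  raised-level-proper : ∀ B j c → (∀ i → i ≢ j → level (point B i) ≡ c) → next (level (point B j)) ≢ c
  raised-level-proper (column x) 0F c others _ with trans (others 1F (λ ())) (sym (others 2F (λ ())))
  ... | ()
  raised-level-proper (column x) 1F c others _ with trans (others 0F (λ ())) (sym (others 2F (λ ())))
  ... | ()
  raised-level-proper (column x) 2F c others _ with trans (others 0F (λ ())) (sym (others 1F (λ ())))
  ... | ()
  raised-level-proper (triangle z d k) 0F c others _ =
    next-≢ k (trans (others 2F (λ ())) (sym (others 1F (λ ()))))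
  raised-level-proper (triangle z d k) 1F c others _ =
    next-≢ k (trans (others 2F (λ ())) (sym (others 0F (λ ()))))
  raised-level-proper (triangle z d k) 2F c others k⁺⁺≡c =
    next²-≢ k (trans k⁺⁺≡c (sym (others 0F (λ ()))))

module Construction (n : ℕ) {{_ : NonZero n}} where
  open Congruence n using (m)
  open Bose n

  bose : TripleSystem Point Block
  bose = record
    { point = point ; point-injective = point-injective ; join = join ; join-∋ = join-∋ ; join-unique = join-unique }

  points : Point ↔ Fin (6 * n + 3)
  points = subst (λ v → Point ↔ Fin v) (3m≡6n+3 n) (↔-sym *↔×)
    where
    3m≡6n+3 : ∀ n → 3 * suc (n + n) ≡ 6 * n + 3
    3m≡6n+3 = solve-∀

  blocks : Block ↔ Fin (m + m * (n * 3))
  blocks = ↔-sym ((↔-id _ ⊎-↔ (↔-id _ ×-↔ *↔×)) ↔-∘ ((↔-id _ ⊎-↔ *↔×) ↔-∘ +↔⊎))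

  open FromTripleSystem bose points blocks public using (sts; transported-coloring; recolored-coloring)
  open Inverse points using () renaming (from to dec)

  level-coloring : Is3Coloring sts (level ∘ dec)
  level-coloring = transported-coloring level level-proper

  level-recolorable : ∀ x → Recolorable sts (level ∘ dec) x
  level-recolorable x =
    next (level (dec x)) , next-≢ _ , recolored-coloring level next level-proper raised-level-proper x

theorem3p3 : ∀ (n : ℕ) → 1 ≤ n →
    (∃ λ (L : STS (6 * n + 3)) → ThreeColorable L × HasDefNum L (6 * n + 3))
    × HasDefNumOrder (6 * n + 3) (6 * n + 3)
theorem3p3 n@(suc _) _ =
  (sts , colorable , defNum) , (sts , (colorable , no-2-coloring sts 3<6n+3) , defNum) , λ D _ _ → hasDefNum-≤ D
  where
  open Construction n
  colorable : ThreeColorable sts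
  colorable = _ , level-coloring
  defNum : HasDefNum sts (6 * n + 3)
  defNum = hasDefNum-order sts level-coloring level-recolorable
  3<6n+3 : 3 < 6 * n + 3
  3<6n+3 = s≤s (m≤n+m 3 _)
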